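{- Let $G=(V,E)$ be a finite simple graph. Then $$Sb_2(G)\le \min\{\deg(u)+\deg(v)+\deg(s)+\deg(t)-2\},$$ where the minimum is taken over all sets $\{u,v,s,t\}\subseteq V$ of four vertices such that $uv,st\in E$ and the subgraph induced on $\{u,v,s,t\}$ has exactly two edges.
   Context: $\gamma(G)$ is the domination number of $G$ (minimum size of a dominating set). $Sb_2(G)$ is the minimum size of a set $\mathcal{E}\subseteq E$ such that $\gamma(G-\mathcal{E})=\gamma(G)+2$. -}

module Defs where

open import Data.Nat using (ℕ; zero; suc; _+_; _≤_; _<ᵇ_)
open import Data.Bool using (Bool; true; false; _∧_; not; if_then_else_)
open import Data.Fin using (Fin; toℕ)
open import Data.List using (List; map; allFin)
open import Data.Nat.ListAction using (sum)
open import Data.Product using (Σ; ∃; _×_; _,_)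
open import Data.Sum using (_⊎_)
open import Relation.Binary.PropositionalEquality using (_≡_; refl; cong₂; trans; sym)

record Graph (n : ℕ) : Set where
  field
    adj    : Fin n → Fin n → Bool
    adjSym : ∀ i j → adj i j ≡ adj j i
    adjIrr : ∀ i → adj i i ≡ false
open Graph public

count : {n : ℕ} → (Fin n → Bool) → ℕ
count {n} p = sum (map (λ i → if p i then 1 else 0) (allFin n))

deg : {n : ℕ} → Graph n → Fin n → ℕ
deg G u = count (adj G u)

record EdgeSet {n : ℕ} (G : Graph n) : Set where
  field
    mem    : Fin n → Fin n → Bool
    memSym : ∀ i j → mem i j ≡ mem j i
    memSub : ∀ i j → mem i j ≡ true → adj G i j ≡ true
open EdgeSet public

edgeCount : {n : ℕ} {G : Graph n} → EdgeSet G → ℕ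
edgeCount {n} F = sum (map (λ i → count (λ j → (toℕ i <ᵇ toℕ j) ∧ mem F i j)) (allFin n))

private
  ∧-comm' : ∀ a b c d → a ≡ b → c ≡ d → (a ∧ not c) ≡ (b ∧ not d)
  ∧-comm' a b c d p q = cong₂ (λ x y → x ∧ not y) p q

_─_ : {n : ℕ} (G : Graph n) → EdgeSet G → Graph n
adj    (G ─ F) i j = adj G i j ∧ not (mem F i j)
adjSym (G ─ F) i j = ∧-comm' _ _ _ _ (adjSym G i j) (memSym F i j)
adjIrr (G ─ F) i rewrite adjIrr G i = refl

Dominating : {n : ℕ} → Graph n → (Fin n → Bool) → Set
Dominating {n} G D = ∀ (v : Fin n) → D v ≡ true ⊎ ∃ λ u → D u ≡ true × adj G u v ≡ true

IsDominationNumber : {n : ℕ} → Graph n → ℕ → Set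
IsDominationNumber {n} G k =
  (Σ (Fin n → Bool) λ D → Dominating G D × count D ≡ k) ×
  (∀ (D : Fin n → Bool) → Dominating G D → k ≤ count D)

module Submission where

-- Delete every edge at u, v, s and t.  Then u, v, s, t are isolated, so every dominating set D
-- contains them; D minus {v, t} still dominates G, because u dominates v, s dominates t, and no
-- other vertex was dominated through v or t.  Hence γ rises by at least 2, which costs
-- deg u + deg v + deg s + deg t − 2 edges (uv and st are counted twice).  Deleting a single edge
-- raises γ by at most 1, so when these edges are deleted one at a time, γ hits γ + 2 exactly.

open import Algebra.Properties.CommutativeSemigroup using (interchange)
open import Data.Bool using (Bool; true; false; _∧_; _∨_; not; if_then_else_)
open import Data.Bool.Properties as Bool
  using ( ∧-assoc; ∧-comm; ∧-zeroʳ; ∧-identityʳ; ∧-conicalˡ; ∧-conicalʳ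
        ; ∨-comm; ∨-zeroʳ; ∨-identityʳ; T-≡)
open import Data.Fin using (Fin; toℕ; zero; suc)
open import Data.Fin.Properties using (_≟_; all?; any?)
open import Data.Fin.Subset.Properties using (anySubset?)
open import Data.List using (List; []; _∷_; map; allFin; tabulate; length; filter; _++_)
open import Data.List.Membership.Propositional using (_∈_)
open import Data.List.Membership.Propositional.Properties
  using (∈-map⁺; ∈-filter⁺; ∈-allFin; ∈-++⁺ˡ; ∈-++⁺ʳ)
open import Data.List.Properties using (map-tabulate; map-cong; length-map; length-++)
open import Data.List.Relation.Unary.Any using (here; there)
open import Data.Nat using (ℕ; _+_; _∸_; _≤_; z≤n; s≤s; _<ᵇ_)
open import Data.Nat.ListAction using (sum)
open import Data.Nat.Properties
  using ( ≤-refl; ≤-trans; ≤-reflexive; ≤-antisym; _≤?_; ≰⇒>; <⇒≱; <-asym; <ᵇ⇒<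
        ; m≤n⇒m<n∨m≡n; m≤m+n
        ; +-comm; +-suc; +-mono-≤; +-monoˡ-≤; m+n∸n≡m; +-commutativeSemigroup; module ≤-Reasoning)
open import Data.Nat.Tactic.RingSolver using (solve-∀)
open import Data.Product using (Σ; ∃; ∃₂; _×_; _,_; proj₁; proj₂)
open import Data.Sum using (_⊎_; inj₁; inj₂)
import Data.Vec as Vec
open import Data.Vec.Properties using (lookup∘tabulate)
open import Defs
open import Function using (_∘_; id)
open import Function.Bundles using (Equivalence)
open import Relation.Binary.PropositionalEquality
open import Relation.Nullary using (¬_; Dec; yes; no; does; contradiction)
open import Relation.Nullary.Decidable using (dec-true; dec-false)
open import Relation.Nullary.Decidable.Core using (T?; map′; _⊎-dec_; _×-dec_)

<ᵇ-asym : ∀ m k → (m <ᵇ k) ≡ true → (k <ᵇ m) ≡ false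
<ᵇ-asym m k m<k with k <ᵇ m in k<m
... | false = refl
... | true  = contradiction (<ᵇ⇒< k m (Equivalence.from T-≡ k<m)) (<-asym (<ᵇ⇒< m k (Equivalence.from T-≡ m<k)))

∧-not-∨ : ∀ a b c → (a ∧ not b) ∧ not c ≡ a ∧ not (b ∨ c)
∧-not-∨ a b c = trans (∧-assoc a (not b) (not c)) (cong (a ∧_) (not-∨ b))
  where
  not-∨ : ∀ b → not b ∧ not c ≡ not (b ∨ c)
  not-∨ true  = refl
  not-∨ false = refl

least-satisfying : {P : ℕ → Set} → (∀ k → Dec (P k)) → (∀ {j k} → j ≤ k → P j → P k) →
                   ∀ {m} → P m → Σ ℕ λ k → P k × (∀ j → P j → k ≤ j)
least-satisfying P? upward {ℕ.zero}  p0 = 0 , p0 , λ _ _ → z≤n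
least-satisfying P? upward {ℕ.suc m} pm with P? m
... | yes p = least-satisfying P? upward p
... | no ¬p = ℕ.suc m , pm , λ j pj → ≰⇒> λ j≤m → ¬p (upward j≤m pj)

sum-map-mono : {A : Set} {f g : A → ℕ} → (∀ x → f x ≤ g x) → ∀ xs → sum (map f xs) ≤ sum (map g xs)
sum-map-mono f≤g []       = z≤n
sum-map-mono f≤g (x ∷ xs) = +-mono-≤ (f≤g x) (sum-map-mono f≤g xs)

sum-map-+ : {A : Set} (f g : A → ℕ) → ∀ xs → sum (map (λ x → f x + g x) xs) ≡ sum (map f xs) + sum (map g xs)
sum-map-+ f g []       = refl
sum-map-+ f g (x ∷ xs) =
  trans (cong (f x + g x +_) (sum-map-+ f g xs)) (interchange +-commutativeSemigroup (f x) (g x) _ _)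

indicator : Bool → ℕ
indicator b = if b then 1 else 0

-- count p is definitionally countIn (allFin n) p.
countIn : {A : Set} → List A → (A → Bool) → ℕ
countIn xs p = sum (map (indicator ∘ p) xs)

module _ {A : Set} where

  countIn-cong : ∀ xs {p q : A → Bool} → (∀ x → p x ≡ q x) → countIn xs p ≡ countIn xs q
  countIn-cong xs p≗q = cong sum (map-cong (cong indicator ∘ p≗q) xs)

  countIn-false : ∀ xs {p : A → Bool} → (∀ x → p x ≡ false) → countIn xs p ≡ 0
  countIn-false []       p≡false = refl
  countIn-false (x ∷ xs) p≡false rewrite p≡false x = countIn-false xs p≡false

  countIn-mono : ∀ xs {p q : A → Bool} → (∀ x → p x ≡ true → q x ≡ true) → countIn xs p ≤ countIn xs q
  countIn-mono xs {p} {q} p⊆q = sum-map-mono indicator-mono xs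
    where
    indicator-mono : ∀ x → indicator (p x) ≤ indicator (q x)
    indicator-mono x with p x in px
    ... | true  rewrite p⊆q x px = ≤-refl
    ... | false = z≤n

  countIn-∨ : ∀ xs (p q : A → Bool) → countIn xs (λ x → p x ∨ q x) ≤ countIn xs p + countIn xs q
  countIn-∨ xs p q = ≤-trans (sum-map-mono indicator-∨ xs) (≤-reflexive (sum-map-+ _ _ xs))
    where
    indicator-∨ : ∀ x → indicator (p x ∨ q x) ≤ indicator (p x) + indicator (q x)
    indicator-∨ x with p x
    ... | true  = s≤s z≤n
    ... | false = ≤-refl

  countIn-split : ∀ xs (p q : A → Bool) →
                  countIn xs p ≡ countIn xs (λ x → p x ∧ not (q x)) + countIn xs (λ x → p x ∧ q x)
  countIn-split xs p q = trans (cong sum (map-cong indicator-split xs)) (sum-map-+ _ _ xs)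
    where
    indicator-split : ∀ x → indicator (p x) ≡ indicator (p x ∧ not (q x)) + indicator (p x ∧ q x)
    indicator-split x with p x | q x
    ... | true  | true  = refl
    ... | true  | false = refl
    ... | false | _     = refl

  length-filter-T : ∀ xs (p : A → Bool) → length (filter (T? ∘ p) xs) ≡ countIn xs p
  length-filter-T []       p = refl
  length-filter-T (x ∷ xs) p with p x
  ... | true  = cong ℕ.suc (length-filter-T xs p)
  ... | false = length-filter-T xs p

countIn-tabulate-suc : ∀ {n} (p : Fin (ℕ.suc n) → Bool) → countIn (tabulate suc) p ≡ count (p ∘ suc)
countIn-tabulate-suc p =
  cong sum (trans (map-tabulate suc (indicator ∘ p)) (sym (map-tabulate id (indicator ∘ p ∘ suc))))

infix 7 _≡ᵇ_
_≡ᵇ_ : ∀ {n} → Fin n → Fin n → Bool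
i ≡ᵇ j = does (i ≟ j)

module _ {n : ℕ} where

  ≡ᵇ-refl : (i : Fin n) → (i ≡ᵇ i) ≡ true
  ≡ᵇ-refl i = dec-true (i ≟ i) refl

  ≢⇒≡ᵇ-false : {i j : Fin n} → ¬ i ≡ j → (i ≡ᵇ j) ≡ false
  ≢⇒≡ᵇ-false {i} {j} = dec-false (i ≟ j)

  ≡ᵇ⇒≡ : {i j : Fin n} → (i ≡ᵇ j) ≡ true → i ≡ j
  ≡ᵇ⇒≡ {i} {j} i≡ᵇj with i ≟ j
  ... | yes i≡j = i≡j
  ... | no  _   = contradiction i≡ᵇj λ ()

  ∧-≡ᵇ⇒≡ : {a b i j : Fin n} → (i ≡ᵇ a ∧ j ≡ᵇ b) ≡ true → i ≡ a × j ≡ b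
  ∧-≡ᵇ⇒≡ q = ≡ᵇ⇒≡ (∧-conicalˡ _ _ q) , ≡ᵇ⇒≡ (∧-conicalʳ _ _ q)

count-≡ᵇ : ∀ {n} (c : Fin n) → count (_≡ᵇ c) ≡ 1
count-≡ᵇ {ℕ.suc n} zero    =
  cong ℕ.suc (trans (countIn-tabulate-suc {n} (_≡ᵇ zero)) (countIn-false (allFin n) λ _ → refl))
count-≡ᵇ {ℕ.suc n} (suc c) = trans (countIn-tabulate-suc {n} (_≡ᵇ suc c)) (count-≡ᵇ c)

count-remove : ∀ {n} (p : Fin n → Bool) {c : Fin n} → p c ≡ true →
               count p ≡ ℕ.suc (count (λ x → p x ∧ not (x ≡ᵇ c)))
count-remove {n} p {c} pc = begin
  count p
    ≡⟨ countIn-split (allFin n) p (_≡ᵇ c) ⟩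
  count p∖c + count (λ x → p x ∧ x ≡ᵇ c)
    ≡⟨ cong (count p∖c +_) (trans (countIn-cong (allFin n) p∧≡ᵇc) (count-≡ᵇ c)) ⟩
  count p∖c + 1
    ≡⟨ +-comm _ 1 ⟩
  ℕ.suc (count p∖c)
    ∎
  where
  open ≡-Reasoning
  p∖c : Fin n → Bool
  p∖c x = p x ∧ not (x ≡ᵇ c)
  p∧≡ᵇc : ∀ x → (p x ∧ x ≡ᵇ c) ≡ (x ≡ᵇ c)
  p∧≡ᵇc x with x ≡ᵇ c in x≡ᵇc
  ... | true  = trans (∧-identityʳ (p x)) (subst (λ y → p y ≡ true) (sym (≡ᵇ⇒≡ x≡ᵇc)) pc)
  ... | false = ∧-zeroʳ (p x)

-- edgeCount F is definitionally countPairs (λ i j → (toℕ i <ᵇ toℕ j) ∧ mem F i j).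
countPairs : ∀ {n} → (Fin n → Fin n → Bool) → ℕ
countPairs {n} R = sum (map (λ i → count (R i)) (allFin n))

module _ {n : ℕ} where

  countPairs-mono : {R S : Fin n → Fin n → Bool} → (∀ i j → R i j ≡ true → S i j ≡ true) →
                    countPairs R ≤ countPairs S
  countPairs-mono R⊆S = sum-map-mono (λ i → countIn-mono (allFin n) (R⊆S i)) (allFin n)

  countPairs-∨ : (R S : Fin n → Fin n → Bool) →
                 countPairs (λ i j → R i j ∨ S i j) ≤ countPairs R + countPairs S
  countPairs-∨ R S = ≤-trans (sum-map-mono (λ i → countIn-∨ (allFin n) (R i) (S i)) (allFin n))
                             (≤-reflexive (sum-map-+ _ _ (allFin n)))

  countPairs-single : (c d : Fin n) → countPairs (λ i j → i ≡ᵇ c ∧ j ≡ᵇ d) ≡ 1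
  countPairs-single c d = trans (cong sum (map-cong row (allFin n))) (count-≡ᵇ c)
    where
    row : ∀ i → count (λ j → i ≡ᵇ c ∧ j ≡ᵇ d) ≡ indicator (i ≡ᵇ c)
    row i with i ≡ᵇ c
    ... | true  = count-≡ᵇ d
    ... | false = countIn-false (allFin n) λ _ → refl

module _ {n : ℕ} (H : Graph n) where

  dominating? : (D : Fin n → Bool) → Dec (Dominating H D)
  dominating? D =
    all? λ v → (D v Bool.≟ true) ⊎-dec any? λ u → (D u Bool.≟ true) ×-dec (adj H u v Bool.≟ true)

  Dominating-resp : {D D' : Fin n → Bool} → (∀ i → D i ≡ D' i) → Dominating H D → Dominating H D'
  Dominating-resp D≗D' dom v with dom v
  ... | inj₁ Dv            = inj₁ (trans (sym (D≗D' v)) Dv)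
  ... | inj₂ (u , Du , uv) = inj₂ (u , trans (sym (D≗D' u)) Du , uv)

  HasDominatingSet : ℕ → Set
  HasDominatingSet k = ∃ λ D → Dominating H D × count D ≤ k

  hasDominatingSet? : ∀ k → Dec (HasDominatingSet k)
  hasDominatingSet? k =
    map′ fromSubset toSubset (anySubset? λ S → dominating? (Vec.lookup S) ×-dec (count (Vec.lookup S) ≤? k))
    where
    fromSubset : ∃ (λ S → Dominating H (Vec.lookup S) × count (Vec.lookup S) ≤ k) → HasDominatingSet k
    fromSubset (S , dom , size) = Vec.lookup S , dom , size
    toSubset : HasDominatingSet k → ∃ (λ S → Dominating H (Vec.lookup S) × count (Vec.lookup S) ≤ k)
    toSubset (D , dom , size) =
      Vec.tabulate D , Dominating-resp lookup-tabulate dom , subst (_≤ k) (countIn-cong (allFin n) lookup-tabulate) size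
      where
      lookup-tabulate : ∀ i → D i ≡ Vec.lookup (Vec.tabulate D) i
      lookup-tabulate i = sym (lookup∘tabulate D i)

  dominationNumber-exists : ∃ (IsDominationNumber H)
  dominationNumber-exists with least-satisfying hasDominatingSet? larger (everything , (λ _ → inj₁ refl) , ≤-refl)
    where
    everything : Fin n → Bool
    everything _ = true
    larger : ∀ {j k} → j ≤ k → HasDominatingSet j → HasDominatingSet k
    larger j≤k (D , dom , size) = D , dom , ≤-trans size j≤k
  ... | k , (D , dom , size) , least =
    k , (D , dom , ≤-antisym size (least _ (D , dom , ≤-refl))) , λ D' dom' → least _ (D' , dom' , ≤-refl)

  IsDominationNumber-unique : ∀ {k l} → IsDominationNumber H k → IsDominationNumber H l → k ≡ l
  IsDominationNumber-unique ((Dk , domk , refl) , leastk) ((Dl , doml , refl) , leastl) =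
    ≤-antisym (leastk Dl doml) (leastl Dk domk)

  γ : ℕ
  γ = proj₁ dominationNumber-exists

  γ-isDominationNumber : IsDominationNumber H γ
  γ-isDominationNumber = proj₂ dominationNumber-exists

  γ-≤-count : ∀ {D} → Dominating H D → γ ≤ count D
  γ-≤-count = proj₂ γ-isDominationNumber _

Isolated : ∀ {n} → Graph n → Fin n → Set
Isolated H x = ∀ y → adj H y x ≡ false

isolated⇒∈dominating : ∀ {n} {H : Graph n} {x D} → Isolated H x → Dominating H D → D x ≡ true
isolated⇒∈dominating {x = x} isolated dom with dom x
... | inj₁ Dx           = Dx
... | inj₂ (y , _ , yx) = contradiction (trans (sym yx) (isolated y)) λ ()

isPair : ∀ {n} → Fin n → Fin n → Fin n → Fin n → Bool
isPair a b i j = (i ≡ᵇ a ∧ j ≡ᵇ b) ∨ (i ≡ᵇ b ∧ j ≡ᵇ a)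

module _ {n : ℕ} where

  isPair-refl : (i j : Fin n) → isPair i j i j ≡ true
  isPair-refl i j rewrite ≡ᵇ-refl i | ≡ᵇ-refl j = refl

  isPair-sym : (a b i j : Fin n) → isPair a b i j ≡ isPair a b j i
  isPair-sym a b i j =
    trans (∨-comm (i ≡ᵇ a ∧ j ≡ᵇ b) _) (cong₂ _∨_ (∧-comm (i ≡ᵇ b) (j ≡ᵇ a)) (∧-comm (i ≡ᵇ a) (j ≡ᵇ b)))

  isPair⇒≡ : {a b i j : Fin n} → isPair a b i j ≡ true → (i ≡ a × j ≡ b) ⊎ (i ≡ b × j ≡ a)
  isPair⇒≡ {a} {b} {i} {j} p with i ≡ᵇ a ∧ j ≡ᵇ b in q
  ... | true  = inj₁ (∧-≡ᵇ⇒≡ q)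
  ... | false = inj₂ (∧-≡ᵇ⇒≡ p)

  isPair-ordered : (a b : Fin n) → ∃₂ λ c d →
                   ∀ {i j} → (toℕ i <ᵇ toℕ j) ≡ true → isPair a b i j ≡ true → i ≡ c × j ≡ d
  isPair-ordered a b with toℕ a <ᵇ toℕ b in a<b
  ... | true  = a , b , ordered
    where
    ordered : ∀ {i j} → (toℕ i <ᵇ toℕ j) ≡ true → isPair a b i j ≡ true → i ≡ a × j ≡ b
    ordered {i} {j} i<j p with isPair⇒≡ {a} {b} {i} {j} p
    ... | inj₁ ij≡ab         = ij≡ab
    ... | inj₂ (refl , refl) = contradiction (trans (sym i<j) (<ᵇ-asym (toℕ a) (toℕ b) a<b)) λ ()
  ... | false = b , a , ordered
    where
    ordered : ∀ {i j} → (toℕ i <ᵇ toℕ j) ≡ true → isPair a b i j ≡ true → i ≡ b × j ≡ a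
    ordered {i} {j} i<j p with isPair⇒≡ {a} {b} {i} {j} p
    ... | inj₁ (refl , refl) = contradiction (trans (sym i<j) a<b) λ ()
    ... | inj₂ ij≡ba         = ij≡ba

module _ {n : ℕ} {G : Graph n} where

  ∅ : EdgeSet G
  mem    ∅ _ _ = false
  memSym ∅ _ _ = refl
  memSub ∅ _ _ ()

  addEdge : EdgeSet G → Fin n × Fin n → EdgeSet G
  mem    (addEdge F (a , b)) i j = mem F i j ∨ (adj G i j ∧ isPair a b i j)
  memSym (addEdge F (a , b)) i j = cong₂ _∨_ (memSym F i j) (cong₂ _∧_ (adjSym G i j) (isPair-sym a b i j))
  memSub (addEdge F (a , b)) i j new with mem F i j in old
  ... | true  = memSub F i j old
  ... | false = ∧-conicalˡ _ _ new

  addEdges : EdgeSet G → List (Fin n × Fin n) → EdgeSet G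
  addEdges F []       = F
  addEdges F (e ∷ es) = addEdges (addEdge F e) es

  addEdges-⊇ : ∀ F es {i j} → mem F i j ≡ true → mem (addEdges F es) i j ≡ true
  addEdges-⊇ F []       old = old
  addEdges-⊇ F (e ∷ es) old = addEdges-⊇ (addEdge F e) es (cong (_∨ _) old)

  addEdges-∈ : ∀ F es {i j} → (i , j) ∈ es → adj G i j ≡ true → mem (addEdges F es) i j ≡ true
  addEdges-∈ F (_ ∷ es) {i} {j} (here refl) ij =
    addEdges-⊇ (addEdge F (i , j)) es (trans (cong (λ x → mem F i j ∨ (x ∧ isPair i j i j)) ij)
                                             (trans (cong (mem F i j ∨_) (isPair-refl i j)) (∨-zeroʳ _)))
  addEdges-∈ F (e ∷ es) (there ∈es) ij = addEdges-∈ (addEdge F e) es ∈es ij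

  edgeCount-∅ : edgeCount ∅ ≡ 0
  edgeCount-∅ = trans (cong sum (map-cong (λ i → countIn-false (allFin n) λ j → ∧-zeroʳ _) (allFin n)))
                      (countIn-false (allFin n) {λ _ → false} λ _ → refl)

  edgeCount-addEdge : (F : EdgeSet G) (e : Fin n × Fin n) → edgeCount (addEdge F e) ≤ ℕ.suc (edgeCount F)
  edgeCount-addEdge F (a , b) with c , d , ordered ← isPair-ordered a b = begin
    edgeCount (addEdge F (a , b))                    ≤⟨ countPairs-mono new⊆ ⟩
    countPairs (λ i j → old i j ∨ single i j)        ≤⟨ countPairs-∨ old single ⟩
    edgeCount F + countPairs single                  ≡⟨ cong (edgeCount F +_) (countPairs-single c d) ⟩
    edgeCount F + 1                                  ≡⟨ +-comm _ 1 ⟩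
    ℕ.suc (edgeCount F)                              ∎
    where
    open ≤-Reasoning
    lt old single : Fin n → Fin n → Bool
    lt i j     = toℕ i <ᵇ toℕ j
    old i j    = lt i j ∧ mem F i j
    single i j = i ≡ᵇ c ∧ j ≡ᵇ d
    new⊆ : ∀ i j → (lt i j ∧ mem (addEdge F (a , b)) i j) ≡ true → (old i j ∨ single i j) ≡ true
    new⊆ i j new with lt i j in i<j | mem F i j
    ... | true | true  = refl
    ... | true | false with refl , refl ← ordered {i} {j} i<j (∧-conicalʳ (adj G i j) _ new) =
      cong₂ _∧_ (≡ᵇ-refl i) (≡ᵇ-refl j)

  Dominating-─∅ : ∀ {D} → Dominating G D → Dominating (G ─ ∅) D
  Dominating-─∅ dom w with dom w
  ... | inj₁ Dw            = inj₁ Dw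
  ... | inj₂ (x , Dx , xw) = inj₂ (x , Dx , trans (∧-identityʳ _) xw)

  γ-─∅ : γ (G ─ ∅) ≤ γ G
  γ-─∅ with (D , dom , size) , _ ← γ-isDominationNumber G =
    subst (γ (G ─ ∅) ≤_) size (γ-≤-count (G ─ ∅) (Dominating-─∅ dom))

  adj-addEdge : ∀ F {a b i j} → isPair a b i j ≡ false → adj (G ─ addEdge F (a , b)) i j ≡ adj (G ─ F) i j
  adj-addEdge F {i = i} {j} p rewrite p | ∧-zeroʳ (adj G i j) | ∨-identityʳ (mem F i j) = refl

  -- Only an endpoint of ab can lose its dominator: b if a ∈ D, and a otherwise.
  Dominating-addEdge : ∀ F a b {D} → Dominating (G ─ F) D →
                       Dominating (G ─ addEdge F (a , b)) (λ x → D x ∨ x ≡ᵇ (if D a then b else a))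
  Dominating-addEdge F a b {D} dom w with D w in Dw
  ... | true  = inj₁ refl
  ... | false with dom w
  ...   | inj₁ Dw≡true       = contradiction (trans (sym Dw) Dw≡true) λ ()
  ...   | inj₂ (x , Dx , xw) with isPair a b x w in p
  ...     | false = inj₂ (x , cong (_∨ x ≡ᵇ (if D a then b else a)) Dx , trans (adj-addEdge F p) xw)
  ...     | true with isPair⇒≡ {a = a} {b} {x} {w} p
  ...       | inj₁ (refl , refl) rewrite Dx = inj₁ (≡ᵇ-refl w)
  ...       | inj₂ (refl , refl) rewrite Dw = inj₁ (≡ᵇ-refl w)

  γ-addEdge : ∀ F e → γ (G ─ addEdge F e) ≤ ℕ.suc (γ (G ─ F))
  γ-addEdge F (a , b) with (D , dom , size) , _ ← γ-isDominationNumber (G ─ F) = begin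
    γ (G ─ addEdge F (a , b))  ≤⟨ γ-≤-count _ (Dominating-addEdge F a b dom) ⟩
    count (λ x → D x ∨ x ≡ᵇ c) ≤⟨ countIn-∨ (allFin n) D (_≡ᵇ c) ⟩
    count D + count (_≡ᵇ c)    ≡⟨ cong₂ _+_ size (count-≡ᵇ c) ⟩
    γ (G ─ F) + 1              ≡⟨ +-comm _ 1 ⟩
    ℕ.suc (γ (G ─ F))          ∎
    where
    open ≤-Reasoning
    c : Fin n
    c = if D a then b else a

  γ-intermediate : ∀ T F es → γ (G ─ F) ≤ T → T ≤ γ (G ─ addEdges F es) →
                   Σ (EdgeSet G) λ F' → edgeCount F' ≤ edgeCount F + length es × γ (G ─ F') ≡ T
  γ-intermediate T F es below above with m≤n⇒m<n∨m≡n below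
  ... | inj₂ γ≡T = F , m≤m+n _ _ , γ≡T
  γ-intermediate T F []       below above | inj₁ γ<T = contradiction above (<⇒≱ γ<T)
  γ-intermediate T F (e ∷ es) below above | inj₁ γ<T
    with F' , size , γ≡T ← γ-intermediate T (addEdge F e) es (≤-trans (γ-addEdge F e) γ<T) above =
    F' , ≤-trans size (≤-trans (+-monoˡ-≤ (length es) (edgeCount-addEdge F e)) (≤-reflexive (sym (+-suc _ _))))
       , γ≡T

  isolated-by-addEdges : ∀ F es {x} → (∀ y → adj G x y ≡ true → (x , y) ∈ es ⊎ (y , x) ∈ es) →
                         Isolated (G ─ addEdges F es) x
  isolated-by-addEdges F es {x} covers y with adj G y x in yx
  ... | false = refl
  ... | true with covers y (trans (adjSym G x y) yx)
  ...   | inj₁ xy∈es rewrite memSym (addEdges F es) y x | addEdges-∈ F es xy∈es (trans (adjSym G x y) yx) = refl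
  ...   | inj₂ yx∈es rewrite addEdges-∈ F es yx∈es yx = refl

  Dominating-without : ∀ F (R : Fin n → Bool) {D} →
    (∀ r → R r ≡ true → Isolated (G ─ F) r) →
    (∀ r → R r ≡ true → ∃ λ x → (D x ∧ not (R x)) ≡ true × adj G x r ≡ true) →
    Dominating (G ─ F) D → Dominating G (λ x → D x ∧ not (R x))
  Dominating-without F R {D} isolated rescued dom w with R w in Rw
  ... | true  = inj₂ (rescued w Rw)
  ... | false with dom w
  ...   | inj₁ Dw            = inj₁ (cong (_∧ true) Dw)
  ...   | inj₂ (x , Dx , xw) with R x in Rx
  ...     | true  = contradiction (trans (sym xw) (trans (adjSym (G ─ F) x w) (isolated x Rx w))) λ ()
  ...     | false = inj₂ (x , cong₂ (λ a b → a ∧ not b) Dx Rx , ∧-conicalˡ _ _ xw)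

  γ-isolating-two-edges : ∀ F {u v s t} → adj G u v ≡ true → adj G s t ≡ true →
    ¬ u ≡ v → ¬ u ≡ t → ¬ s ≡ v → ¬ s ≡ t → ¬ v ≡ t →
    Isolated (G ─ F) u → Isolated (G ─ F) v → Isolated (G ─ F) s → Isolated (G ─ F) t →
    γ G + 2 ≤ γ (G ─ F)
  γ-isolating-two-edges F {u} {v} {s} {t} uv st u≢v u≢t s≢v s≢t v≢t iso-u iso-v iso-s iso-t
    with (D , dom , size) , _ ← γ-isDominationNumber (G ─ F) = begin
    γ G + 2       ≤⟨ +-monoˡ-≤ 2 (γ-≤-count G (Dominating-without F R R-isolated rescued dom)) ⟩
    count D' + 2  ≡⟨ +-comm (count D') 2 ⟩
    2 + count D'  ≡⟨ count-D ⟨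
    count D       ≡⟨ size ⟩
    γ (G ─ F)     ∎
    where
    open ≤-Reasoning
    R D' : Fin n → Bool
    R x  = x ≡ᵇ v ∨ x ≡ᵇ t
    D' x = D x ∧ not (R x)

    ∈D : ∀ {x} → Isolated (G ─ F) x → D x ≡ true
    ∈D iso = isolated⇒∈dominating {H = G ─ F} iso dom

    ∈D' : ∀ {x} → ¬ x ≡ v → ¬ x ≡ t → D x ≡ true → D' x ≡ true
    ∈D' x≢v x≢t Dx rewrite ≢⇒≡ᵇ-false x≢v | ≢⇒≡ᵇ-false x≢t | Dx = refl

    R-isolated : ∀ r → R r ≡ true → Isolated (G ─ F) r
    R-isolated r Rr with r ≡ᵇ v in r≡ᵇv
    ... | true  with refl ← ≡ᵇ⇒≡ {i = r} {v} r≡ᵇv = iso-v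
    ... | false with refl ← ≡ᵇ⇒≡ {i = r} {t} Rr   = iso-t

    rescued : ∀ r → R r ≡ true → ∃ λ x → D' x ≡ true × adj G x r ≡ true
    rescued r Rr with r ≡ᵇ v in r≡ᵇv
    ... | true  with refl ← ≡ᵇ⇒≡ {i = r} {v} r≡ᵇv = u , ∈D' u≢v u≢t (∈D iso-u) , uv
    ... | false with refl ← ≡ᵇ⇒≡ {i = r} {t} Rr   = s , ∈D' s≢v s≢t (∈D iso-s) , st

    count-D : count D ≡ 2 + count D'
    count-D = begin-equality
      count D
        ≡⟨ count-remove D (∈D iso-v) ⟩
      ℕ.suc (count D∖v)
        ≡⟨ cong ℕ.suc (count-remove D∖v t∈D∖v) ⟩
      2 + count (λ x → D∖v x ∧ not (x ≡ᵇ t))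
        ≡⟨ cong (2 +_) (countIn-cong (allFin n) λ x → ∧-not-∨ (D x) _ _) ⟩
      2 + count D'
        ∎
      where
      D∖v : Fin n → Bool
      D∖v x = D x ∧ not (x ≡ᵇ v)
      t∈D∖v : D∖v t ≡ true
      t∈D∖v rewrite ∈D iso-t | ≢⇒≡ᵇ-false (v≢t ∘ sym) = refl

star : ∀ {n} → Fin n → (Fin n → Bool) → List (Fin n × Fin n)
star {n} x p = map (x ,_) (filter (T? ∘ p) (allFin n))

module _ {n : ℕ} (x : Fin n) (p : Fin n → Bool) where

  length-star : length (star x p) ≡ count p
  length-star = trans (length-map (x ,_) (filter (T? ∘ p) (allFin n))) (length-filter-T (allFin n) p)

  ∈-star : ∀ {y} → p y ≡ true → (x , y) ∈ star x p
  ∈-star {y} py = ∈-map⁺ (x ,_) (∈-filter⁺ (T? ∘ p) (∈-allFin y) (Equivalence.from T-≡ py))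

module _ {n : ℕ} (G : Graph n) (u v s t : Fin n) where

  -- The pairs (v, u) and (t, s) are left out, so that uv and st are listed once.
  edgesAt : List (Fin n × Fin n)
  edgesAt = star u (adj G u) ++ star v (λ y → adj G v y ∧ not (y ≡ᵇ u))
         ++ star s (adj G s) ++ star t (λ y → adj G t y ∧ not (y ≡ᵇ s))

  length-edgesAt : adj G u v ≡ true → adj G s t ≡ true →
                   length edgesAt ≡ deg G u + deg G v + deg G s + deg G t ∸ 2
  length-edgesAt uv st = begin
    length edgesAt
      ≡⟨ lengths ⟩
    deg G u + (count pv + (deg G s + count pt))
      ≡⟨ m+n∸n≡m _ 2 ⟨
    deg G u + (count pv + (deg G s + count pt)) + 2 ∸ 2
      ≡⟨ cong (_∸ 2) (rearrange (deg G u) (count pv) (deg G s) (count pt)) ⟩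
    deg G u + ℕ.suc (count pv) + deg G s + ℕ.suc (count pt) ∸ 2
      ≡⟨ cong₂ (λ dv dt → deg G u + dv + deg G s + dt ∸ 2) deg-v deg-t ⟨
    deg G u + deg G v + deg G s + deg G t ∸ 2
      ∎
    where
    open ≡-Reasoning
    pv pt : Fin n → Bool
    pv y = adj G v y ∧ not (y ≡ᵇ u)
    pt y = adj G t y ∧ not (y ≡ᵇ s)
    lengths : length edgesAt ≡ deg G u + (count pv + (deg G s + count pt))
    lengths rewrite length-++ (star u (adj G u)) {star v pv ++ star s (adj G s) ++ star t pt}
                  | length-++ (star v pv) {star s (adj G s) ++ star t pt}
                  | length-++ (star s (adj G s)) {star t pt}
                  | length-star u (adj G u) | length-star v pv | length-star s (adj G s) | length-star t pt = refl
    rearrange : ∀ a b c d → a + (b + (c + d)) + 2 ≡ a + ℕ.suc b + c + ℕ.suc d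
    rearrange = solve-∀
    deg-v : deg G v ≡ ℕ.suc (count pv)
    deg-v = count-remove (adj G v) (trans (adjSym G v u) uv)
    deg-t : deg G t ≡ ℕ.suc (count pt)
    deg-t = count-remove (adj G t) (trans (adjSym G t s) st)

  private
    ∈-star-except : ∀ {x y w} → adj G x y ≡ true → ¬ y ≡ w →
                    (x , y) ∈ star x (λ y → adj G x y ∧ not (y ≡ᵇ w))
    ∈-star-except xy y≢w = ∈-star _ _ (cong₂ (λ a b → a ∧ not b) xy (≢⇒≡ᵇ-false y≢w))

  module _ (F : EdgeSet G) where

    edgesAt-isolates-u : Isolated (G ─ addEdges F edgesAt) u
    edgesAt-isolates-u = isolated-by-addEdges F edgesAt λ y uy → inj₁ (∈-++⁺ˡ (∈-star u _ uy))

    edgesAt-isolates-v : adj G u v ≡ true → Isolated (G ─ addEdges F edgesAt) v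
    edgesAt-isolates-v uv = isolated-by-addEdges F edgesAt covers
      where
      covers : ∀ y → adj G v y ≡ true → (v , y) ∈ edgesAt ⊎ (y , v) ∈ edgesAt
      covers y vy with y ≟ u
      ... | yes refl = inj₂ (∈-++⁺ˡ (∈-star u _ uv))
      ... | no  y≢u  = inj₁ (∈-++⁺ʳ (star u _) (∈-++⁺ˡ (∈-star-except vy y≢u)))

    edgesAt-isolates-s : Isolated (G ─ addEdges F edgesAt) s
    edgesAt-isolates-s = isolated-by-addEdges F edgesAt λ y sy →
      inj₁ (∈-++⁺ʳ (star u _) (∈-++⁺ʳ (star v _) (∈-++⁺ˡ (∈-star s _ sy))))

    edgesAt-isolates-t : adj G s t ≡ true → Isolated (G ─ addEdges F edgesAt) t
    edgesAt-isolates-t st = isolated-by-addEdges F edgesAt covers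
      where
      covers : ∀ y → adj G t y ≡ true → (t , y) ∈ edgesAt ⊎ (y , t) ∈ edgesAt
      covers y ty with y ≟ s
      ... | yes refl = inj₂ (∈-++⁺ʳ (star u _) (∈-++⁺ʳ (star v _) (∈-++⁺ˡ (∈-star s _ st))))
      ... | no  y≢s  =
        inj₁ (∈-++⁺ʳ (star u _) (∈-++⁺ʳ (star v _) (∈-++⁺ʳ (star s _) (∈-star-except ty y≢s))))

theorem5 : {n : ℕ} (G : Graph n) (u v s t : Fin n) →
    ¬ u ≡ v → ¬ u ≡ s → ¬ u ≡ t → ¬ v ≡ s → ¬ v ≡ t → ¬ s ≡ t →
    adj G u v ≡ true → adj G s t ≡ true →
    adj G u s ≡ false → adj G u t ≡ false → adj G v s ≡ false → adj G v t ≡ false →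
    Σ (EdgeSet G) λ F →
    (edgeCount F ≤ deg G u + deg G v + deg G s + deg G t ∸ 2) ×
    (∀ (g : ℕ) → IsDominationNumber G g → IsDominationNumber (G ─ F) (g + 2))
theorem5 G u v s t u≢v _ u≢t v≢s v≢t s≢t uv st _ _ _ _ =
  let F , size , γ≡ = γ-intermediate (γ G + 2) ∅ es (≤-trans (γ-─∅ {G = G}) (m≤m+n _ 2)) above
  in  F
    , ≤-trans size (≤-reflexive (cong₂ _+_ (edgeCount-∅ {G = G}) (length-edgesAt G u v s t uv st)))
    , raised F γ≡
  where
  es : List (Fin _ × Fin _)
  es = edgesAt G u v s t

  above : γ G + 2 ≤ γ (G ─ addEdges ∅ es)
  above = γ-isolating-two-edges _ uv st u≢v u≢t (v≢s ∘ sym) s≢t v≢t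
            (edgesAt-isolates-u G u v s t ∅) (edgesAt-isolates-v G u v s t ∅ uv)
            (edgesAt-isolates-s G u v s t ∅) (edgesAt-isolates-t G u v s t ∅ st)

  raised : ∀ F → γ (G ─ F) ≡ γ G + 2 → ∀ g → IsDominationNumber G g → IsDominationNumber (G ─ F) (g + 2)
  raised F γ≡ g isγ = subst (IsDominationNumber (G ─ F))
                        (trans γ≡ (cong (_+ 2) (IsDominationNumber-unique G (γ-isDominationNumber G) isγ)))
                        (γ-isDominationNumber (G ─ F))
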